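{- There exists a block-divisible sequence in $\mathbb{Z}^+$, i.e. a strictly increasing sequence $(s_n)_{n \in \mathbb{Z}^+}$ of positive integers such that for all finite non-empty sets $A, B \subseteq \mathbb{Z}^+$ with $\max A < \min B$, the integer $s_A := \sum_{n \in A} s_n$ divides $s_B := \sum_{n \in B} s_n$.
   Context: For a sequence $(s_n)$ and a finite non-empty set $A \subseteq \mathbb{Z}^+$, $s_A := \sum_{n \in A} s_n$. For finite non-empty $A, B \subseteq \mathbb{Z}^+$, write $A \prec B$ iff $\max A < \min B$. A block-divisible sequence is a strictly increasing sequence $(s_n)$ in $\mathbb{Z}^+$ such that $s_A \mid s_B$ whenever $A \prec B$. -}

module Defs where

open import Data.Nat using (ℕ; _<_)
open import Data.Nat.Divisibility using (_∣_)
open import Data.List using (List; []; _∷_; map)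
open import Data.Nat.ListAction using (sum)
open import Data.List.Relation.Unary.All using (All)
open import Data.List.Relation.Unary.Unique.Propositional using (Unique)
open import Relation.Binary.PropositionalEquality using (_≢_)
open import Data.Product using (_×_)

-- Finite non-empty subset of ℤ⁺, represented as a list of pairwise distinct
-- natural numbers, all ≥ 1, and non-empty.
FinNonEmptyPosSet : List ℕ → Set
FinNonEmptyPosSet A = (A ≢ []) × Unique A × All (λ n → 0 < n) A

sumOver : (ℕ → ℕ) → List ℕ → ℕ
sumOver s A = sum (map s A)

-- A ≺ B  iff  max A < min B, i.e. every element of A is below every element of B
_≺_ : List ℕ → List ℕ → Set
A ≺ B = All (λ a → All (λ b → a < b) B) A

-- strictly increasing sequence of positive integers indexed by ℤ⁺ = {1,2,...}
-- (the value at index 0 is irrelevant)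
StrictlyIncreasingPos : (ℕ → ℕ) → Set
StrictlyIncreasingPos s =
  (∀ n → 0 < n → 0 < s n) × (∀ m n → 0 < m → m < n → s m < s n)

BlockDivisible : (ℕ → ℕ) → Set
BlockDivisible s =
  StrictlyIncreasingPos s ×
  (∀ A B → FinNonEmptyPosSet A → FinNonEmptyPosSet B → A ≺ B →
     sumOver s A ∣ sumOver s B)

module Submission where

-- Put  F n = s 0 + s 1 + ... + s (n-1)  and  s n = (F n + 1)! .
-- Then s is strictly increasing, because s m ≤ F n < F n + 1 ≤ (F n + 1)! = s n
-- whenever m < n.  For block divisibility, let A ≺ B.  Since A consists of
-- distinct indices, all below any b ∈ B, its block sum is bounded by the full
-- prefix sum:  s_A ≤ F b < F b + 1.  A positive number not exceeding F b + 1
-- divides (F b + 1)! = s b, so s_A divides every term of s_B, hence s_B itself.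

open import Defs
open import Data.Nat using (ℕ; zero; suc; _+_; _≤_; _<_; _<?_; z≤n; s≤s; _!)
open import Data.Nat.Properties
open import Data.Nat.Divisibility using (_∣_; m∣m*n; ∣-trans; ∣⇒≤; ∣m∣n⇒∣m+n; _∣0; m≤n⇒m!∣n!)
open import Data.Product using (∃; _,_)
open import Data.List using (List; []; _∷_; filter)
open import Data.List.Properties using (filter-all; filter-accept; filter-reject)
open import Data.List.Relation.Unary.All as All using (All; []; _∷_)
open import Data.List.Relation.Unary.All.Properties using (all-filter)
import Data.List.Relation.Unary.Unique.Propositional.Properties as Unique
open import Data.List.Relation.Unary.AllPairs using ([]; _∷_)
open import Data.List.Relation.Unary.Unique.Propositional using (Unique)
open import Relation.Binary.PropositionalEquality using (_≡_; _≢_; refl; sym; cong; module ≡-Reasoning)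
open import Relation.Nullary using (yes; no; contradiction)
open import Function using (_∘_)
open import Algebra.Properties.CommutativeSemigroup +-commutativeSemigroup using (x∙yz≈y∙xz)

partialSum : (ℕ → ℕ) → ℕ → ℕ
partialSum f zero = 0
partialSum f (suc c) = f c + partialSum f c

sumOver≤top+rest : ∀ f c xs → Unique xs → All (_< suc c) xs →
                   sumOver f xs ≤ f c + sumOver f (filter (_<? c) xs)
sumOver≤top+rest f c [] _ _ = z≤n
sumOver≤top+rest f c (x ∷ xs) (x∉xs ∷ xs!) (s≤s x≤c ∷ xs<1+c) with x <? c
... | yes x<c = begin
    f x + sumOver f xs                     ≤⟨ +-monoʳ-≤ (f x) (sumOver≤top+rest f c xs xs! xs<1+c) ⟩
    f x + (f c + sumOver f (keep xs))      ≡⟨ x∙yz≈y∙xz (f x) (f c) (sumOver f (keep xs)) ⟩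
    f c + sumOver f (x ∷ keep xs)          ≡⟨ cong (λ ys → f c + sumOver f ys) (filter-accept (_<? c) x<c) ⟨
    f c + sumOver f (keep (x ∷ xs))        ∎
  where
    open ≤-Reasoning
    keep : List ℕ → List ℕ
    keep = filter (_<? c)
... | no x≮c with ≤∧≮⇒≡ x≤c x≮c
...   | refl = ≤-reflexive (cong (λ ys → f x + sumOver f ys) (begin
    xs                      ≡⟨ filter-all (_<? x) xs<x ⟨
    filter (_<? x) xs       ≡⟨ filter-reject (_<? x) x≮c ⟨
    filter (_<? x) (x ∷ xs) ∎))
  where
    open ≡-Reasoning
    -- the other indices are ≤ x and distinct from x, hence all below x
    xs<x : All (_< x) xs
    xs<x = All.zipWith (λ (y<1+x , x≢y) → ≤∧≢⇒< (≤-pred y<1+x) (x≢y ∘ sym)) (xs<1+c , x∉xs)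

sumOver≤partialSum : ∀ f b xs → Unique xs → All (_< b) xs → sumOver f xs ≤ partialSum f b
sumOver≤partialSum f zero [] _ _ = z≤n
sumOver≤partialSum f zero (_ ∷ _) _ (() ∷ _)
sumOver≤partialSum f (suc c) xs xs! xs<1+c = begin
  sumOver f xs                          ≤⟨ sumOver≤top+rest f c xs xs! xs<1+c ⟩
  f c + sumOver f (filter (_<? c) xs)   ≤⟨ +-monoʳ-≤ (f c) (sumOver≤partialSum f c _
                                             (Unique.filter⁺ (_<? c) xs!) (all-filter (_<? c) xs)) ⟩
  f c + partialSum f c                  ∎
  where open ≤-Reasoning

∣-factorial : ∀ {a n} → 0 < a → a ≤ n → a ∣ n !
∣-factorial {suc k} _ a≤n = ∣-trans (m∣m*n (k !)) (m≤n⇒m!∣n! a≤n)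

∣-sumOver : ∀ {d} f xs → All (λ x → d ∣ f x) xs → d ∣ sumOver f xs
∣-sumOver f [] [] = _ ∣0
∣-sumOver f (x ∷ xs) (d∣fx ∷ d∣fxs) = ∣m∣n⇒∣m+n d∣fx (∣-sumOver f xs d∣fxs)

sumOver-pos : ∀ f xs → (∀ n → 0 < f n) → xs ≢ [] → 0 < sumOver f xs
sumOver-pos f [] _ xs≢[] = contradiction refl xs≢[]
sumOver-pos f (x ∷ xs) f-pos _ = ≤-trans (f-pos x) (m≤m+n (f x) (sumOver f xs))

mutual
  F : ℕ → ℕ
  F zero = 0
  F (suc c) = s c + F c

  s : ℕ → ℕ
  s n = suc (F n) !

F≡partialSum : ∀ n → F n ≡ partialSum s n
F≡partialSum zero = refl
F≡partialSum (suc c) = cong (s c +_) (F≡partialSum c)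

s-pos : ∀ n → 0 < s n
s-pos n = 1≤n! (suc (F n))

-- s n exceeds the prefix sum F n, since m ≤ m! for m = F n + 1.
F<s : ∀ n → F n < s n
F<s n = ∣⇒≤ {{suc (F n) !≢0}} (m∣m*n (F n !))

-- s is strictly increasing: the single term s m is part of the prefix sum F n.
s-increasing : ∀ m n → m < n → s m < s n
s-increasing m n m<n = begin-strict
  s m                    ≡⟨ +-identityʳ (s m) ⟨
  sumOver s (m ∷ [])     ≤⟨ sumOver≤partialSum s n (m ∷ []) ([] ∷ []) (m<n ∷ []) ⟩
  partialSum s n         ≡⟨ F≡partialSum n ⟨
  F n                    <⟨ F<s n ⟩
  s n                    ∎
  where open ≤-Reasoning

block∣s : ∀ A b → A ≢ [] → Unique A → All (_< b) A → sumOver s A ∣ s b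
block∣s A b A≢[] A! A<b = ∣-factorial (sumOver-pos s A s-pos A≢[]) (begin
  sumOver s A     ≤⟨ sumOver≤partialSum s b A A! A<b ⟩
  partialSum s b  ≡⟨ F≡partialSum b ⟨
  F b             ≤⟨ n≤1+n (F b) ⟩
  suc (F b)       ∎)
  where open ≤-Reasoning

mainTheorem2 : ∃ λ (s : ℕ → ℕ) → BlockDivisible s
mainTheorem2 = s , ((λ n _ → s-pos n) , λ m n _ → s-increasing m n) , block-divisible
  where
    -- every index of B lies above all of A, so s_A divides each term of s_B
    block-divisible : ∀ A B → FinNonEmptyPosSet A → FinNonEmptyPosSet B → A ≺ B →
                      sumOver s A ∣ sumOver s B
    block-divisible A B (A≢[] , A! , _) _ A≺B =
      ∣-sumOver s B (All.tabulate λ b∈B → block∣s A _ A≢[] A! (All.map (λ a<B → All.lookup a<B b∈B) A≺B))
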